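{- Let $\Gamma=\{A,B,C\}$ be a relevant collection of three different sets. Then $\Gamma$ is an hke collection if and only if $$|A-B-C|=|(B\cap C)-A|.$$
   Context: A relevant collection is a finite collection $F$ of finite sets all having the same cardinality, a positive integer denoted $\alpha(F)$. A collection $F$ of sets is an hereditary Konig–Egervary (hke) collection if there is a positive integer $\alpha$ such that $|\bigcup\Gamma|+|\bigcap\Gamma|=2\alpha$ for every non-empty subcollection $\Gamma\subseteq F$. -}

module Defs where

open import Data.Nat using (ℕ; zero; suc; _+_; _*_; _>_)
open import Data.Fin using (Fin; zero; suc)
open import Data.Fin.Subset using (Subset; Nonempty; ⋃; ⋂; ∣_∣; inside; outside)
open import Data.Vec using (Vec; []; _∷_)
open import Data.List using (List; []; _∷_)
open import Data.Product using (Σ; _×_)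
open import Relation.Binary.PropositionalEquality using (_≡_)

Collection : ℕ → ℕ → Set
Collection m n = Fin m → Subset n

members : ∀ {m n} → Collection m n → Subset m → List (Subset n)
members {zero}  F []            = []
members {suc m} F (inside  ∷ S) = F zero ∷ members (λ i → F (suc i)) S
members {suc m} F (outside ∷ S) = members (λ i → F (suc i)) S

Relevant : ∀ {m n} → Collection m n → Set
Relevant F = Σ ℕ λ α → (α > 0) × (∀ i → ∣ F i ∣ ≡ α)

HKE : ∀ {m n} → Collection m n → Set
HKE {m} F = Σ ℕ λ α → (α > 0) ×
  ((S : Subset m) → Nonempty S →
     ∣ ⋃ (members F S) ∣ + ∣ ⋂ (members F S) ∣ ≡ 2 * α)

triple : ∀ {n} → Subset n → Subset n → Subset n → Collection 3 n
triple A B C zero             = A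
triple A B C (suc zero)       = B
triple A B C (suc (suc zero)) = C

-- Cardinality is additive over the points of the ground set, so the two
-- counting identities |X ∪ Y| + |X ∩ Y| = |X| + |Y| and
--   |A ∪ B ∪ C| + |A ∩ B ∩ C| + |(B ∩ C) − A| = |A − B − C| + |B| + |C|
-- reduce to one-point checks. With |A| = |B| = |C| = α, the first makes every
-- subcollection of at most two sets satisfy the hke equation with 2α for free,
-- and the second, by cancelling |B| + |C| = 2α, turns the equation for {A, B, C}
-- itself into |A − B − C| = |(B ∩ C) − A|.
module Submission where

open import Defs
open import Data.Nat using (ℕ; suc; _+_; _*_; _>_)
open import Data.Nat.Properties
  using (+-commutativeSemigroup; +-cancelʳ-≡; +-comm; +-assoc; +-identityʳ)
open import Algebra.Properties.CommutativeSemigroup +-commutativeSemigroup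
  using (interchange)
open import Data.Fin using (zero; suc)
open import Data.Fin.Subset
  using (Subset; Side; inside; outside; ⊥; ⊤; ∣_∣; _∪_; _∩_; _─_; ⋃; ⋂; Nonempty)
open import Data.Fin.Subset.Properties using (∪-identityʳ; ∩-identityʳ)
open import Data.Vec using ([]; _∷_; [_]; head; tail; here; there)
open import Data.List using (List; []; _∷_)
open import Data.Product using (_,_)
open import Relation.Binary.PropositionalEquality
  using (_≡_; _≢_; refl; sym; trans; cong; cong₂; module ≡-Reasoning)
open import Function.Bundles using (_⇔_; mk⇔; Equivalence)

open ≡-Reasoning

private
  variable
    n : ℕ

+-interchange₃ : ∀ a b c u v w →
  (a + u) + (b + v) + (c + w) ≡ (a + b + c) + (u + v + w)
+-interchange₃ a b c u v w = begin
  (a + u) + (b + v) + (c + w)    ≡⟨ cong (_+ (c + w)) (interchange a u b v) ⟩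
  (a + b) + (u + v) + (c + w)    ≡⟨ interchange (a + b) (u + v) c w ⟩
  (a + b + c) + (u + v + w)      ∎

∣p∣≡∣[head]∣+∣tail∣ : (p : Subset (suc n)) → ∣ p ∣ ≡ ∣ [ head p ] ∣ + ∣ tail p ∣
∣p∣≡∣[head]∣+∣tail∣ (inside  ∷ p) = refl
∣p∣≡∣[head]∣+∣tail∣ (outside ∷ p) = refl

∣p∪q∣+∣p∩q∣≡∣p∣+∣q∣ : (p q : Subset n) → ∣ p ∪ q ∣ + ∣ p ∩ q ∣ ≡ ∣ p ∣ + ∣ q ∣
∣p∪q∣+∣p∩q∣≡∣p∣+∣q∣ [] [] = refl
∣p∪q∣+∣p∩q∣≡∣p∣+∣q∣ p@(x ∷ p′) q@(y ∷ q′) = begin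
  ∣ p ∪ q ∣ + ∣ p ∩ q ∣
    ≡⟨ cong₂ _+_ (∣p∣≡∣[head]∣+∣tail∣ (p ∪ q)) (∣p∣≡∣[head]∣+∣tail∣ (p ∩ q)) ⟩
  (∣ [ x ] ∪ [ y ] ∣ + ∣ p′ ∪ q′ ∣) + (∣ [ x ] ∩ [ y ] ∣ + ∣ p′ ∩ q′ ∣)
    ≡⟨ interchange ∣ [ x ] ∪ [ y ] ∣ _ _ _ ⟩
  (∣ [ x ] ∪ [ y ] ∣ + ∣ [ x ] ∩ [ y ] ∣) + (∣ p′ ∪ q′ ∣ + ∣ p′ ∩ q′ ∣)
    ≡⟨ cong₂ _+_ (pointwise x y) (∣p∪q∣+∣p∩q∣≡∣p∣+∣q∣ p′ q′) ⟩
  (∣ [ x ] ∣ + ∣ [ y ] ∣) + (∣ p′ ∣ + ∣ q′ ∣)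
    ≡⟨ interchange ∣ [ x ] ∣ _ _ _ ⟩
  (∣ [ x ] ∣ + ∣ p′ ∣) + (∣ [ y ] ∣ + ∣ q′ ∣)
    ≡⟨ sym (cong₂ _+_ (∣p∣≡∣[head]∣+∣tail∣ p) (∣p∣≡∣[head]∣+∣tail∣ q)) ⟩
  ∣ p ∣ + ∣ q ∣
    ∎
  where
  pointwise : (x y : Side) →
    ∣ [ x ] ∪ [ y ] ∣ + ∣ [ x ] ∩ [ y ] ∣ ≡ ∣ [ x ] ∣ + ∣ [ y ] ∣
  pointwise inside  inside  = refl
  pointwise inside  outside = refl
  pointwise outside inside  = refl
  pointwise outside outside = refl

∣p∪q∪r∣+∣p∩q∩r∣+∣q∩r─p∣≡∣p─q─r∣+∣q∣+∣r∣ : (p q r : Subset n) →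
  ∣ p ∪ q ∪ r ∣ + ∣ p ∩ q ∩ r ∣ + ∣ q ∩ r ─ p ∣ ≡ ∣ p ─ q ─ r ∣ + ∣ q ∣ + ∣ r ∣
∣p∪q∪r∣+∣p∩q∩r∣+∣q∩r─p∣≡∣p─q─r∣+∣q∣+∣r∣ [] [] [] = refl
∣p∪q∪r∣+∣p∩q∩r∣+∣q∩r─p∣≡∣p─q─r∣+∣q∣+∣r∣ p@(x ∷ p′) q@(y ∷ q′) r@(z ∷ r′) = begin
  ∣ p ∪ q ∪ r ∣ + ∣ p ∩ q ∩ r ∣ + ∣ q ∩ r ─ p ∣
    ≡⟨ cong₂ _+_ (cong₂ _+_ (∣p∣≡∣[head]∣+∣tail∣ (p ∪ q ∪ r))
                            (∣p∣≡∣[head]∣+∣tail∣ (p ∩ q ∩ r)))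
                 (∣p∣≡∣[head]∣+∣tail∣ (q ∩ r ─ p)) ⟩
  (∣ [ x ] ∪ [ y ] ∪ [ z ] ∣ + ∣ p′ ∪ q′ ∪ r′ ∣)
    + (∣ [ x ] ∩ [ y ] ∩ [ z ] ∣ + ∣ p′ ∩ q′ ∩ r′ ∣)
    + (∣ [ y ] ∩ [ z ] ─ [ x ] ∣ + ∣ q′ ∩ r′ ─ p′ ∣)
    ≡⟨ +-interchange₃ ∣ [ x ] ∪ [ y ] ∪ [ z ] ∣ _ _ _ _ _ ⟩
  (∣ [ x ] ∪ [ y ] ∪ [ z ] ∣ + ∣ [ x ] ∩ [ y ] ∩ [ z ] ∣ + ∣ [ y ] ∩ [ z ] ─ [ x ] ∣)
    + (∣ p′ ∪ q′ ∪ r′ ∣ + ∣ p′ ∩ q′ ∩ r′ ∣ + ∣ q′ ∩ r′ ─ p′ ∣)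
    ≡⟨ cong₂ _+_ (pointwise x y z) (∣p∪q∪r∣+∣p∩q∩r∣+∣q∩r─p∣≡∣p─q─r∣+∣q∣+∣r∣ p′ q′ r′) ⟩
  (∣ [ x ] ─ [ y ] ─ [ z ] ∣ + ∣ [ y ] ∣ + ∣ [ z ] ∣) + (∣ p′ ─ q′ ─ r′ ∣ + ∣ q′ ∣ + ∣ r′ ∣)
    ≡⟨ sym (+-interchange₃ ∣ [ x ] ─ [ y ] ─ [ z ] ∣ _ _ _ _ _) ⟩
  (∣ [ x ] ─ [ y ] ─ [ z ] ∣ + ∣ p′ ─ q′ ─ r′ ∣) + (∣ [ y ] ∣ + ∣ q′ ∣) + (∣ [ z ] ∣ + ∣ r′ ∣)
    ≡⟨ sym (cong₂ _+_ (cong₂ _+_ (∣p∣≡∣[head]∣+∣tail∣ (p ─ q ─ r))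
                                 (∣p∣≡∣[head]∣+∣tail∣ q))
                      (∣p∣≡∣[head]∣+∣tail∣ r)) ⟩
  ∣ p ─ q ─ r ∣ + ∣ q ∣ + ∣ r ∣
    ∎
  where
  pointwise : (x y z : Side) →
    ∣ [ x ] ∪ [ y ] ∪ [ z ] ∣ + ∣ [ x ] ∩ [ y ] ∩ [ z ] ∣ + ∣ [ y ] ∩ [ z ] ─ [ x ] ∣
      ≡ ∣ [ x ] ─ [ y ] ─ [ z ] ∣ + ∣ [ y ] ∣ + ∣ [ z ] ∣
  pointwise inside  inside  inside  = refl
  pointwise inside  inside  outside = refl
  pointwise inside  outside inside  = refl
  pointwise inside  outside outside = refl
  pointwise outside inside  inside  = refl
  pointwise outside inside  outside = refl
  pointwise outside outside inside  = refl
  pointwise outside outside outside = refl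

m+n≡o+p⇒[m≡p⇔o≡n] : ∀ {m n o p} → m + n ≡ o + p → (m ≡ p ⇔ o ≡ n)
m+n≡o+p⇒[m≡p⇔o≡n] {m} {n} {o} {p} m+n≡o+p = mk⇔
  (λ { refl → sym (+-cancelʳ-≡ m n o (trans (+-comm n m) m+n≡o+p)) })
  (λ { refl → +-cancelʳ-≡ n m p (trans m+n≡o+p (+-comm o p)) })

m≡o⇒n≡o⇒m+n≡2*o : ∀ {m n o} → m ≡ o → n ≡ o → m + n ≡ 2 * o
m≡o⇒n≡o⇒m+n≡2*o {o = o} refl refl = cong (o +_) (sym (+-identityʳ o))

KE-sum : List (Subset n) → ℕ
KE-sum Γ = ∣ ⋃ Γ ∣ + ∣ ⋂ Γ ∣

KE-sum[p]≡∣p∣+∣p∣ : (p : Subset n) → KE-sum (p ∷ []) ≡ ∣ p ∣ + ∣ p ∣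
KE-sum[p]≡∣p∣+∣p∣ p = cong₂ _+_ (cong ∣_∣ (∪-identityʳ p)) (cong ∣_∣ (∩-identityʳ p))

KE-sum[p,q]≡∣p∣+∣q∣ : (p q : Subset n) → KE-sum (p ∷ q ∷ []) ≡ ∣ p ∣ + ∣ q ∣
KE-sum[p,q]≡∣p∣+∣q∣ p q = begin
  ∣ p ∪ q ∪ ⊥ ∣ + ∣ p ∩ q ∩ ⊤ ∣
    ≡⟨ cong₂ (λ s t → ∣ p ∪ s ∣ + ∣ p ∩ t ∣) (∪-identityʳ q) (∩-identityʳ q) ⟩
  ∣ p ∪ q ∣ + ∣ p ∩ q ∣
    ≡⟨ ∣p∪q∣+∣p∩q∣≡∣p∣+∣q∣ p q ⟩
  ∣ p ∣ + ∣ q ∣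
    ∎

KE-sum[p,q,r]≡∣q∣+∣r∣⇔∣p─q─r∣≡∣q∩r─p∣ : (p q r : Subset n) →
  KE-sum (p ∷ q ∷ r ∷ []) ≡ ∣ q ∣ + ∣ r ∣ ⇔ ∣ p ─ q ─ r ∣ ≡ ∣ q ∩ r ─ p ∣
KE-sum[p,q,r]≡∣q∣+∣r∣⇔∣p─q─r∣≡∣q∩r─p∣ p q r = m+n≡o+p⇒[m≡p⇔o≡n] (begin
  ∣ p ∪ q ∪ r ∪ ⊥ ∣ + ∣ p ∩ q ∩ r ∩ ⊤ ∣ + ∣ q ∩ r ─ p ∣
    ≡⟨ cong₂ (λ s t → ∣ p ∪ q ∪ s ∣ + ∣ p ∩ q ∩ t ∣ + ∣ q ∩ r ─ p ∣)
             (∪-identityʳ r) (∩-identityʳ r) ⟩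
  ∣ p ∪ q ∪ r ∣ + ∣ p ∩ q ∩ r ∣ + ∣ q ∩ r ─ p ∣
    ≡⟨ ∣p∪q∪r∣+∣p∩q∩r∣+∣q∩r─p∣≡∣p─q─r∣+∣q∣+∣r∣ p q r ⟩
  ∣ p ─ q ─ r ∣ + ∣ q ∣ + ∣ r ∣
    ≡⟨ +-assoc (∣ p ─ q ─ r ∣) (∣ q ∣) (∣ r ∣) ⟩
  ∣ p ─ q ─ r ∣ + (∣ q ∣ + ∣ r ∣)
    ∎)

triple-HKE : ∀ {α} {A B C : Subset n} → α > 0 → (∀ i → ∣ triple A B C i ∣ ≡ α) →
  KE-sum (A ∷ B ∷ C ∷ []) ≡ 2 * α → HKE (triple A B C)
triple-HKE {n = n} {α} {A} {B} {C} α>0 ∣F∣≡α full = α , α>0 , ke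
  where
  ∣A∣≡α : ∣ A ∣ ≡ α
  ∣A∣≡α = ∣F∣≡α zero
  ∣B∣≡α : ∣ B ∣ ≡ α
  ∣B∣≡α = ∣F∣≡α (suc zero)
  ∣C∣≡α : ∣ C ∣ ≡ α
  ∣C∣≡α = ∣F∣≡α (suc (suc zero))
  single : (p : Subset n) → ∣ p ∣ ≡ α → KE-sum (p ∷ []) ≡ 2 * α
  single p ∣p∣≡α = trans (KE-sum[p]≡∣p∣+∣p∣ p) (m≡o⇒n≡o⇒m+n≡2*o ∣p∣≡α ∣p∣≡α)
  pair : (p q : Subset n) → ∣ p ∣ ≡ α → ∣ q ∣ ≡ α → KE-sum (p ∷ q ∷ []) ≡ 2 * α
  pair p q ∣p∣≡α ∣q∣≡α = trans (KE-sum[p,q]≡∣p∣+∣q∣ p q) (m≡o⇒n≡o⇒m+n≡2*o ∣p∣≡α ∣q∣≡α)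
  ke : (S : Subset 3) → Nonempty S → KE-sum (members (triple A B C) S) ≡ 2 * α
  ke (outside ∷ outside ∷ outside ∷ []) (_ , there (there (there ())))
  ke (inside  ∷ outside ∷ outside ∷ []) _ = single A ∣A∣≡α
  ke (outside ∷ inside  ∷ outside ∷ []) _ = single B ∣B∣≡α
  ke (outside ∷ outside ∷ inside  ∷ []) _ = single C ∣C∣≡α
  ke (inside  ∷ inside  ∷ outside ∷ []) _ = pair A B ∣A∣≡α ∣B∣≡α
  ke (inside  ∷ outside ∷ inside  ∷ []) _ = pair A C ∣A∣≡α ∣C∣≡α
  ke (outside ∷ inside  ∷ inside  ∷ []) _ = pair B C ∣B∣≡α ∣C∣≡α
  ke (inside  ∷ inside  ∷ inside  ∷ []) _ = full

corollary2p4 : (n : ℕ) (A B C : Subset n) →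
    A ≢ B → A ≢ C → B ≢ C →
    Relevant (triple A B C) →
    (HKE (triple A B C) ⇔ (∣ A ─ B ─ C ∣ ≡ ∣ (B ∩ C) ─ A ∣))
corollary2p4 n A B C _ _ _ (α , α>0 , ∣F∣≡α) = mk⇔
  (λ hke → to (KE-sum[A,B,C]≡∣B∣+∣C∣ hke))
  (λ ∣A─B─C∣≡∣B∩C─A∣ → triple-HKE α>0 ∣F∣≡α (trans (from ∣A─B─C∣≡∣B∩C─A∣) ∣B∣+∣C∣≡2α))
  where
  open Equivalence (KE-sum[p,q,r]≡∣q∣+∣r∣⇔∣p─q─r∣≡∣q∩r─p∣ A B C)
  ∣B∣+∣C∣≡2α : ∣ B ∣ + ∣ C ∣ ≡ 2 * α
  ∣B∣+∣C∣≡2α = m≡o⇒n≡o⇒m+n≡2*o (∣F∣≡α (suc zero)) (∣F∣≡α (suc (suc zero)))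
  KE-sum[A,B,C]≡∣B∣+∣C∣ : HKE (triple A B C) → KE-sum (A ∷ B ∷ C ∷ []) ≡ ∣ B ∣ + ∣ C ∣
  KE-sum[A,B,C]≡∣B∣+∣C∣ (β , _ , ke) = begin
    KE-sum (A ∷ B ∷ C ∷ [])  ≡⟨ ke (inside ∷ inside ∷ inside ∷ []) (zero , here) ⟩
    2 * β                    ≡⟨ sym (ke (inside ∷ outside ∷ outside ∷ []) (zero , here)) ⟩
    KE-sum (A ∷ [])          ≡⟨ KE-sum[p]≡∣p∣+∣p∣ A ⟩
    ∣ A ∣ + ∣ A ∣            ≡⟨ cong₂ _+_ (trans (∣F∣≡α zero) (sym (∣F∣≡α (suc zero))))
                                          (trans (∣F∣≡α zero) (sym (∣F∣≡α (suc (suc zero))))) ⟩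
    ∣ B ∣ + ∣ C ∣            ∎
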